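{- For every primitive recursive function $f:\mathbb{N}^n\to\mathbb{N}$ there is a term $M_f$ such that $\vdash M_f:\mathbb{U}^0\multimap^n\mathbb{U}^0$ is derivable in $\mathsf{H}(\emptyset)$ and $M_f$ represents $f$, i.e. $M_f\,\ulcorner m_1\urcorner\cdots\ulcorner m_n\urcorner\leadsto^*\ulcorner f(m_1,\dots,m_n)\urcorner$ for all $m_1,\dots,m_n\in\mathbb{N}$.
   Context: Free algebras: a free algebra $\mathbb{A}=(\mathcal{C}_\mathbb{A},\mathcal{R}_\mathbb{A})$: finite constructor set $\{c^\mathbb{A}_1,\dots,c^\mathbb{A}_{k(\mathbb{A})}\}$ with arities. $\mathscr{A}$ is a fixed finite family of free algebras with pairwise disjoint constructor sets containing: $\mathbb{U}$ ($c_1^\mathbb{U}$ unary, $c_2^\mathbb{U}$ nullary), $\mathbb{B}$ ($c_1^\mathbb{B},c_2^\mathbb{B}$ unary, $c_3^\mathbb{B}$ nullary), $\mathbb{C}$ ($c_1^\mathbb{C}$ binary, $c_2^\mathbb{C}$ nullary), $\mathbb{D}$ ($c_1^\mathbb{D},c_2^\mathbb{D}$ binary, $c_3^\mathbb{D}$ nullary). Numerals: $\ulcorner 0\urcorner=c_2^\mathbb{U}$, $\ulcorner n+1\urcorner=c_1^\mathbb{U}\ulcorner n\urcorner$. Terms: $M::=x\mid c\mid MM\mid \lambda x.M\mid M\{\!\{M,\dots,M\}\!\}\mid M\langle\!\langle M,\dots,M\rangle\!\rangle$. Types: $A::=\mathbb{A}^n\mid A\multimap A$. $A\multimap^0B=B$,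 $A\multimap^{n+1}B=A\multimap(A\multimap^nB)$. Typing rules: (A) $x:A\vdash x:A$; (W) from $\Gamma\vdash M:B$ infer $\Gamma,x:A\vdash M:B$; (C) from $\Gamma,x:A,y:A\vdash M:B$ infer $\Gamma,z:A\vdash M\{z/x,z/y\}:B$; ($I_\multimap$) from $\Gamma,x:A\vdash M:B$ infer $\Gamma\vdash\lambda x.M:A\multimap B$; ($E_\multimap$) from $\Gamma\vdash M:A\multimap B$, $\Delta\vdash N:A$ infer $\Gamma,\Delta\vdash MN:B$; ($I_\mathbb{A}$) $\vdash c:\mathbb{A}^n\multimap^{\mathcal{R}(c)}\mathbb{A}^n$; ($E^C_\mathbb{A}$) from $\Gamma_i\vdash M_{c^\mathbb{A}_i}:\mathbb{A}^m\multimap^{\mathcal{R}(c^\mathbb{A}_i)}C$ and $\Delta\vdash L:\mathbb{A}^m$ infer $\Gamma_1,\dots,\Gamma_{k(\mathbb{A})},\Delta\vdash L\{\!\{M_{c_1^\mathbb{A}},\dots\}\!\}:C$; ($E^R_\mathbb{A}$) from $\Gamma_i\vdash M_{c^\mathbb{A}_i}:\mathbb{A}^m\multimap^{\mathcal{R}(c^\mathbb{A}_i)}(C\multimap^{\mathcal{R}(c^\mathbb{A}_i)}C)$ and $\Delta\vdash L:\mathbb{A}^m$ infer $\Gamma_1,\dots,\Gamma_{k(\mathbb{A})},\Delta\vdash L\langle\!\langle M_{c_1^\mathbb{A}},\dots\rangle\!\rangle:C$. The system $\mathsf{H}(\emptyset)$ uses these rules but never allows rule (C), and requires all contexts $\Gamma_i$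 in rule $E^R_\mathbb{A}$ to be empty. Values $V::=x\mid\lambda x.M\mid T$, $T::=c\mid TT$. Reduction $\to$: $(\lambda x.M)V\to M\{V/x\}$; $c_i^\mathbb{A}t_1\cdots t_r\{\!\{M_{c_1},\dots,M_{c_k}\}\!\}\to M_{c_i}t_1\cdots t_r$; $c_i^\mathbb{A}t_1\cdots t_r\langle\!\langle\vec M\rangle\!\rangle\to M_{c_i}t_1\cdots t_r(t_1\langle\!\langle\vec M\rangle\!\rangle)\cdots(t_r\langle\!\langle\vec M\rangle\!\rangle)$ with $r=\mathcal{R}(c_i^\mathbb{A})$, $t_j$ constructor terms. $\leadsto$ is the closure of $\to$ under application contexts on both sides and under the scrutinee position of conditionals/recursions (not under $\lambda$, not inside branches); $\leadsto^*$ its reflexive-transitive closure. -}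

module Defs where

open import Data.Nat using (ℕ; zero; suc)
open import Data.Fin using (Fin; toℕ)
open import Data.List using (List; []; _∷_; length; map; allFin; lookup)
open import Data.Vec as V using (Vec)
open import Data.Maybe using (Maybe; just; nothing)
open import Data.Product using (Σ; _,_; _×_)
open import Relation.Binary.PropositionalEquality using (_≡_; subst; sym)
open import Relation.Binary.Construct.Closure.ReflexiveTransitive using (Star)

data PR : ℕ → Set where
  zer  : ∀ {n} → PR n
  succ : PR 1
  proj : ∀ {n} → Fin n → PR n
  comp : ∀ {m n} → PR m → Vec (PR n) m → PR n
  prec : ∀ {n} → PR n → PR (suc (suc n)) → PR (suc n)

mutual
  eval : ∀ {n} → PR n → Vec ℕ n → ℕ
  eval zer xs = 0
  eval succ (x V.∷ V.[]) = suc x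
  eval (proj i) xs = V.lookup xs i
  eval (comp h gs) xs = eval h (evalV gs xs)
  eval (prec g h) (zero V.∷ xs) = eval g xs
  eval (prec g h) (suc y V.∷ xs) = eval h (y V.∷ eval (prec g h) (y V.∷ xs) V.∷ xs)

  evalV : ∀ {m n} → Vec (PR n) m → Vec ℕ n → Vec ℕ m
  evalV V.[] xs = V.[]
  evalV (g V.∷ gs) xs = eval g xs V.∷ evalV gs xs

data Nth {A : Set} : List A → ℕ → A → Set where
  here  : ∀ {x xs} → Nth (x ∷ xs) 0 x
  there : ∀ {x y xs i} → Nth xs i x → Nth (y ∷ xs) (suc i) x

-- A finite family 𝒜 of free algebras.  Algebra a has constructors
-- c^a_1,…,c^a_{k(a)} with arities given by the list  sig a  (so
-- k(a) = length (sig a), arity of c^a_{i+1} = lookup (sig a) i).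
-- Constructors of distinct algebras are distinct (pairs (a , i)).

record Family : Set where
  field
    K     : ℕ
    sig   : Fin K → List ℕ
    𝕌 𝔹 ℂ 𝔻 : Fin K
    𝕌-sig : sig 𝕌 ≡ 1 ∷ 0 ∷ []
    𝔹-sig : sig 𝔹 ≡ 1 ∷ 1 ∷ 0 ∷ []
    ℂ-sig : sig ℂ ≡ 2 ∷ 0 ∷ []
    𝔻-sig : sig 𝔻 ≡ 2 ∷ 2 ∷ 0 ∷ []

module H (F : Family) where
  open Family F

  k : Fin K → ℕ
  k a = length (sig a)

  -- constructors: (a , i) is c^a_{i+1}
  Con : Set
  Con = Σ (Fin K) (λ a → Fin (k a))

  alg : Con → Fin K
  alg (a , i) = a

  R : Con → ℕ
  R (a , i) = lookup (sig a) i

  data Tm (n : ℕ) : Set where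
    var : Fin n → Tm n
    con : Con → Tm n
    _·_ : Tm n → Tm n → Tm n
    lam : Tm (suc n) → Tm n
    cas : Tm n → List (Tm n) → Tm n
    rec : Tm n → List (Tm n) → Tm n

  infixl 7 _·_

  apps : ∀ {n} → Tm n → List (Tm n) → Tm n
  apps M [] = M
  apps M (N ∷ Ns) = apps (M · N) Ns

  ext : ∀ {n m} → (Fin n → Fin m) → Fin (suc n) → Fin (suc m)
  ext ρ Fin.zero = Fin.zero
  ext ρ (Fin.suc i) = Fin.suc (ρ i)

  mutual
    ren : ∀ {n m} → (Fin n → Fin m) → Tm n → Tm m
    ren ρ (var i) = var (ρ i)
    ren ρ (con c) = con c
    ren ρ (M · N) = ren ρ M · ren ρ N
    ren ρ (lam M) = lam (ren (ext ρ) M)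
    ren ρ (cas L Ms) = cas (ren ρ L) (renL ρ Ms)
    ren ρ (rec L Ms) = rec (ren ρ L) (renL ρ Ms)

    renL : ∀ {n m} → (Fin n → Fin m) → List (Tm n) → List (Tm m)
    renL ρ [] = []
    renL ρ (M ∷ Ms) = ren ρ M ∷ renL ρ Ms

  exts : ∀ {n m} → (Fin n → Tm m) → Fin (suc n) → Tm (suc m)
  exts σ Fin.zero = var Fin.zero
  exts σ (Fin.suc i) = ren Fin.suc (σ i)

  mutual
    sub : ∀ {n m} → (Fin n → Tm m) → Tm n → Tm m
    sub σ (var i) = σ i
    sub σ (con c) = con c
    sub σ (M · N) = sub σ M · sub σ N
    sub σ (lam M) = lam (sub (exts σ) M)
    sub σ (cas L Ms) = cas (sub σ L) (subL σ Ms)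
    sub σ (rec L Ms) = rec (sub σ L) (subL σ Ms)

    subL : ∀ {n m} → (Fin n → Tm m) → List (Tm n) → List (Tm m)
    subL σ [] = []
    subL σ (M ∷ Ms) = sub σ M ∷ subL σ Ms

  _[_]₀ : ∀ {n} → Tm (suc n) → Tm n → Tm n
  M [ V ]₀ = sub σ M
    where
    σ : _ → _
    σ Fin.zero = V
    σ (Fin.suc i) = var i

  data IsCT {n} : Tm n → Set where
    con : ∀ c → IsCT (con c)
    app : ∀ {T S} → IsCT T → IsCT S → IsCT (T · S)

  data AllCT {n} : List (Tm n) → Set where
    []  : AllCT []
    _∷_ : ∀ {t ts} → IsCT t → AllCT ts → AllCT (t ∷ ts)

  data Value {n} : Tm n → Set where
    var : ∀ i → Value (var i)
    lam : ∀ M → Value (lam M)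
    ct  : ∀ {T} → IsCT T → Value T

  data _⟶_ {n} : Tm n → Tm n → Set where
    β   : ∀ {M V} → Value V → (lam M · V) ⟶ (M [ V ]₀)
    cas : ∀ {c ts Ms M} → AllCT ts → length ts ≡ R c →
          length Ms ≡ k (alg c) → Nth Ms (toℕ (Data.Product.proj₂ c)) M →
          cas (apps (con c) ts) Ms ⟶ apps M ts
    rec : ∀ {c ts Ms M} → AllCT ts → length ts ≡ R c →
          length Ms ≡ k (alg c) → Nth Ms (toℕ (Data.Product.proj₂ c)) M →
          rec (apps (con c) ts) Ms ⟶ apps (apps M ts) (map (λ t → rec t Ms) ts)

  data _⇝_ {n} : Tm n → Tm n → Set where
    root : ∀ {M N} → M ⟶ N → M ⇝ N
    appl : ∀ {M M' N} → M ⇝ M' → (M · N) ⇝ (M' · N)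
    appr : ∀ {M N N'} → N ⇝ N' → (M · N) ⇝ (M · N')
    casL : ∀ {L L' Ms} → L ⇝ L' → cas L Ms ⇝ cas L' Ms
    recL : ∀ {L L' Ms} → L ⇝ L' → rec L Ms ⇝ rec L' Ms

  _⇝*_ : ∀ {n} → Tm n → Tm n → Set
  _⇝*_ = Star _⇝_

  data Ty : Set where
    at  : Fin K → ℕ → Ty
    _⊸_ : Ty → Ty → Ty

  infixr 5 _⊸_

  _⊸^_∙_ : Ty → ℕ → Ty → Ty
  A ⊸^ zero ∙ B = B
  A ⊸^ suc n ∙ B = A ⊸ (A ⊸^ n ∙ B)

  -- Rule (C) is absent; rule E^R requires empty branch contexts.

  Ctx : ℕ → Set
  Ctx n = Vec (Maybe Ty) n

  ε : ∀ {n} → Ctx n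
  ε = V.replicate _ nothing

  only : ∀ {n} → Fin n → Ty → Ctx n
  only i A = ε V.[ i ]≔ just A

  data Split : ∀ {n} → Ctx n → Ctx n → Ctx n → Set where
    []    : Split V.[] V.[] V.[]
    none  : ∀ {n} {Γ Γ₁ Γ₂ : Ctx n} → Split Γ Γ₁ Γ₂ →
            Split (nothing V.∷ Γ) (nothing V.∷ Γ₁) (nothing V.∷ Γ₂)
    left  : ∀ {n A} {Γ Γ₁ Γ₂ : Ctx n} → Split Γ Γ₁ Γ₂ →
            Split (just A V.∷ Γ) (just A V.∷ Γ₁) (nothing V.∷ Γ₂)
    right : ∀ {n A} {Γ Γ₁ Γ₂ : Ctx n} → Split Γ Γ₁ Γ₂ →
            Split (just A V.∷ Γ) (nothing V.∷ Γ₁) (just A V.∷ Γ₂)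

  brC : Fin K → ℕ → Ty → List Ty
  brC a m C = map (λ i → at a m ⊸^ R (a , i) ∙ C) (allFin (k a))

  brR : Fin K → ℕ → Ty → List Ty
  brR a m C = map (λ i → at a m ⊸^ R (a , i) ∙ (C ⊸^ R (a , i) ∙ C)) (allFin (k a))

  mutual
    data _⊢_∶_ {n} : Ctx n → Tm n → Ty → Set where
      ax   : ∀ {i A} → only i A ⊢ var i ∶ A
      wk   : ∀ {Γ M B i A} → V.lookup Γ i ≡ nothing →
             Γ ⊢ M ∶ B → (Γ V.[ i ]≔ just A) ⊢ M ∶ B
      ⊸I   : ∀ {Γ M A B} → (just A V.∷ Γ) ⊢ M ∶ B → Γ ⊢ lam M ∶ (A ⊸ B)
      ⊸E   : ∀ {Γ Γ₁ Γ₂ M N A B} → Split Γ Γ₁ Γ₂ →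
             Γ₁ ⊢ M ∶ (A ⊸ B) → Γ₂ ⊢ N ∶ A → Γ ⊢ (M · N) ∶ B
      conI : ∀ {c ℓ} → ε ⊢ con c ∶ (at (alg c) ℓ ⊸^ R c ∙ at (alg c) ℓ)
      casE : ∀ {Γ Γ₁ Δ a m C L Ms} → Split Γ Γ₁ Δ →
             Γ₁ ⊢* Ms ∶ brC a m C → Δ ⊢ L ∶ at a m → Γ ⊢ cas L Ms ∶ C
      recE : ∀ {Δ a m C L Ms} →
             ε ⊢* Ms ∶ brR a m C → Δ ⊢ L ∶ at a m → Δ ⊢ rec L Ms ∶ C

    data _⊢*_∶_ {n} : Ctx n → List (Tm n) → List Ty → Set where
      []  : ε ⊢* [] ∶ []
      cons : ∀ {Γ Γ₁ Γ₂ M Ms A As} → Split Γ Γ₁ Γ₂ → Γ₁ ⊢ M ∶ A →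
             Γ₂ ⊢* Ms ∶ As → Γ ⊢* (M ∷ Ms) ∶ (A ∷ As)

  cU₁ cU₂ : Con        -- c^𝕌_1 (unary), c^𝕌_2 (nullary)
  cU₁ = 𝕌 , subst (λ l → Fin (length l)) (sym 𝕌-sig) Fin.zero
  cU₂ = 𝕌 , subst (λ l → Fin (length l)) (sym 𝕌-sig) (Fin.suc Fin.zero)

  ⌜_⌝ : ℕ → Tm 0
  ⌜ zero ⌝ = con cU₂
  ⌜ suc n ⌝ = con cU₁ · ⌜ n ⌝

  U⁰ : Ty
  U⁰ = at 𝕌 0

-- Each of Kleene's schemes is realised by closed combinators: discard n ignores n
-- numerals, share n A B x⃗ ⇝* A x⃗ (B x⃗), and rotate n moves the first of n + 1 arguments
-- to the end. As f (y + 1) = share n (rotate n (h y)) (f y) pointwise, primitive recursion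
-- is a single recursor on 𝕌 with closed branches. Without contraction, share must
-- duplicate each argument: a numeral is copied by recursion on itself, in
-- continuation-passing style, copy ⌜m⌝ K ⇝* K ⌜m⌝ ⌜m⌝.
-- Correctness is a logical relation: Rep n P f M says that M, applied to numerals one at
-- a time, reduces at every stage to a value (reduction does not go under λ, and β fires
-- only on values) and finally to one P-related to f x₁ … xₙ. The reduction law of each
-- combinator transports Rep, so encode f computes the curried function ⟦ f ⟧ assembled
-- from the matching operations on functions, and ⟦ f ⟧ agrees with eval f.
module Submission where

open import Defs
open import Data.Nat using (ℕ; zero; suc)
open import Data.Fin using (Fin; zero; suc; toℕ; #_)
open import Data.Vec as V using (Vec; toList; []; _∷_)
open import Data.List as L using (List; []; _∷_; map; length; allFin)
open import Data.Product using (Σ; _×_; _,_)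
open import Data.Maybe using (just; nothing)
open import Function using (_∘_)
open import Relation.Binary.PropositionalEquality
  using (_≡_; refl; sym; trans; cong; cong₂; subst; module ≡-Reasoning)
open import Relation.Binary.Construct.Closure.ReflexiveTransitive as Star
  using (_◅_; _◅◅_; gmap; return)

private variable
  n m p : ℕ
  X : Set

-- Curried functions

Curried : ℕ → Set → Set
Curried zero X = X
Curried (suc n) X = ℕ → Curried n X

infixl 6 _$ⁿ_
_$ⁿ_ : Curried n X → Vec ℕ n → X
f $ⁿ [] = f
f $ⁿ (x ∷ xs) = f x $ⁿ xs

constⁿ : ∀ n → X → Curried n X
constⁿ zero x = x
constⁿ (suc n) x _ = constⁿ n x

shareⁿ : ∀ n → Curried n (ℕ → X) → Curried n ℕ → Curried n X
shareⁿ zero a b = a b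
shareⁿ (suc n) a b x = shareⁿ n (a x) (b x)

rotateⁿ : ∀ n → (ℕ → Curried n X) → Curried n (ℕ → X)
rotateⁿ zero a = a
rotateⁿ (suc n) a x = rotateⁿ n (λ z → a z x)

projⁿ : Fin n → Curried n ℕ
projⁿ {suc n} zero = constⁿ n
projⁿ (suc i) _ = projⁿ i

primrecⁿ : ∀ n → Curried n ℕ → Curried (suc (suc n)) ℕ → Curried (suc n) ℕ
primrecⁿ n g h zero = g
primrecⁿ n g h (suc y) = shareⁿ n (rotateⁿ n (h y)) (primrecⁿ n g h y)

constⁿ-$ⁿ : ∀ {x : X} (xs : Vec ℕ n) → constⁿ n x $ⁿ xs ≡ x
constⁿ-$ⁿ [] = refl
constⁿ-$ⁿ (_ ∷ xs) = constⁿ-$ⁿ xs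

shareⁿ-$ⁿ : ∀ {a : Curried n (ℕ → X)} {b} (xs : Vec ℕ n) →
            shareⁿ n a b $ⁿ xs ≡ (a $ⁿ xs) (b $ⁿ xs)
shareⁿ-$ⁿ [] = refl
shareⁿ-$ⁿ (_ ∷ xs) = shareⁿ-$ⁿ xs

rotateⁿ-$ⁿ : ∀ {a : ℕ → Curried n X} (xs : Vec ℕ n) z → (rotateⁿ n a $ⁿ xs) z ≡ a z $ⁿ xs
rotateⁿ-$ⁿ [] z = refl
rotateⁿ-$ⁿ (_ ∷ xs) z = rotateⁿ-$ⁿ xs z

projⁿ-$ⁿ : (i : Fin n) (xs : Vec ℕ n) → projⁿ i $ⁿ xs ≡ V.lookup xs i
projⁿ-$ⁿ zero (x ∷ xs) = constⁿ-$ⁿ xs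
projⁿ-$ⁿ (suc i) (_ ∷ xs) = projⁿ-$ⁿ i xs

mutual
  ⟦_⟧ : PR n → Curried n ℕ
  ⟦_⟧ {n} zer = constⁿ n 0
  ⟦ succ ⟧ = suc
  ⟦ proj i ⟧ = projⁿ i
  ⟦_⟧ {n} (comp h gs) = composeⁿ (constⁿ n ⟦ h ⟧) gs
  ⟦_⟧ {suc n} (prec g h) = primrecⁿ n ⟦ g ⟧ ⟦ h ⟧

  composeⁿ : Curried n (Curried m ℕ) → Vec (PR n) m → Curried n ℕ
  composeⁿ a [] = a
  composeⁿ {n} a (g ∷ gs) = composeⁿ (shareⁿ n a ⟦ g ⟧) gs

mutual
  ⟦⟧-$ⁿ : (f : PR n) (xs : Vec ℕ n) → ⟦ f ⟧ $ⁿ xs ≡ eval f xs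
  ⟦⟧-$ⁿ zer xs = constⁿ-$ⁿ xs
  ⟦⟧-$ⁿ succ (x ∷ []) = refl
  ⟦⟧-$ⁿ (proj i) xs = projⁿ-$ⁿ i xs
  ⟦⟧-$ⁿ {n} (comp h gs) xs = begin
    composeⁿ (constⁿ n ⟦ h ⟧) gs $ⁿ xs     ≡⟨ composeⁿ-$ⁿ gs xs ⟩
    (constⁿ n ⟦ h ⟧ $ⁿ xs) $ⁿ evalV gs xs  ≡⟨ cong (_$ⁿ evalV gs xs) (constⁿ-$ⁿ xs) ⟩
    ⟦ h ⟧ $ⁿ evalV gs xs                   ≡⟨ ⟦⟧-$ⁿ h (evalV gs xs) ⟩
    eval h (evalV gs xs)                   ∎
    where open ≡-Reasoning
  ⟦⟧-$ⁿ (prec g h) (y ∷ xs) = primrecⁿ-$ⁿ g h y xs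

  composeⁿ-$ⁿ : ∀ {a : Curried n (Curried m ℕ)} (gs : Vec (PR n) m) → ∀ xs →
                composeⁿ a gs $ⁿ xs ≡ (a $ⁿ xs) $ⁿ evalV gs xs
  composeⁿ-$ⁿ [] xs = refl
  composeⁿ-$ⁿ {n} {a = a} (g ∷ gs) xs = begin
    composeⁿ (shareⁿ n a ⟦ g ⟧) gs $ⁿ xs     ≡⟨ composeⁿ-$ⁿ gs xs ⟩
    (shareⁿ n a ⟦ g ⟧ $ⁿ xs) $ⁿ evalV gs xs  ≡⟨ cong (_$ⁿ evalV gs xs) (shareⁿ-$ⁿ xs) ⟩
    (a $ⁿ xs) (⟦ g ⟧ $ⁿ xs) $ⁿ evalV gs xs   ≡⟨ cong (λ y → (a $ⁿ xs) y $ⁿ evalV gs xs) (⟦⟧-$ⁿ g xs) ⟩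
    (a $ⁿ xs) $ⁿ (eval g xs ∷ evalV gs xs)   ∎
    where open ≡-Reasoning

  primrecⁿ-$ⁿ : (g : PR n) (h : PR (suc (suc n))) → ∀ y xs →
                primrecⁿ n ⟦ g ⟧ ⟦ h ⟧ y $ⁿ xs ≡ eval (prec g h) (y ∷ xs)
  primrecⁿ-$ⁿ g h zero xs = ⟦⟧-$ⁿ g xs
  primrecⁿ-$ⁿ {n} g h (suc y) xs = begin
    shareⁿ n (rotateⁿ n (⟦ h ⟧ y)) r $ⁿ xs        ≡⟨ shareⁿ-$ⁿ xs ⟩
    (rotateⁿ n (⟦ h ⟧ y) $ⁿ xs) (r $ⁿ xs)         ≡⟨ rotateⁿ-$ⁿ xs (r $ⁿ xs) ⟩
    ⟦ h ⟧ $ⁿ (y ∷ r $ⁿ xs ∷ xs)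
      ≡⟨ cong (λ z → ⟦ h ⟧ $ⁿ (y ∷ z ∷ xs)) (primrecⁿ-$ⁿ g h y xs) ⟩
    ⟦ h ⟧ $ⁿ (y ∷ eval (prec g h) (y ∷ xs) ∷ xs)  ≡⟨ ⟦⟧-$ⁿ h _ ⟩
    eval (prec g h) (suc y ∷ xs)                  ∎
    where
    open ≡-Reasoning
    r = primrecⁿ n ⟦ g ⟧ ⟦ h ⟧ y

module Representation (𝒜 : Family) where
  open Family 𝒜 using (𝕌; 𝕌-sig)
  open H 𝒜

  -- Substitution and closed terms

  exts-ext : {σ : Fin m → Tm p} {ρ : Fin n → Fin m} {τ : Fin n → Tm p} →
             (∀ i → σ (ρ i) ≡ τ i) → ∀ i → exts σ (ext ρ i) ≡ exts τ i
  exts-ext e zero = refl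
  exts-ext e (suc i) = cong (ren suc) (e i)

  mutual
    sub-ren : {σ : Fin m → Tm p} {ρ : Fin n → Fin m} {τ : Fin n → Tm p} →
              (∀ i → σ (ρ i) ≡ τ i) → ∀ M → sub σ (ren ρ M) ≡ sub τ M
    sub-ren e (var i) = e i
    sub-ren e (con c) = refl
    sub-ren e (M · N) = cong₂ _·_ (sub-ren e M) (sub-ren e N)
    sub-ren e (lam M) = cong lam (sub-ren (exts-ext e) M)
    sub-ren e (cas L Ms) = cong₂ cas (sub-ren e L) (subL-ren e Ms)
    sub-ren e (rec L Ms) = cong₂ rec (sub-ren e L) (subL-ren e Ms)

    subL-ren : {σ : Fin m → Tm p} {ρ : Fin n → Fin m} {τ : Fin n → Tm p} →
               (∀ i → σ (ρ i) ≡ τ i) → ∀ Ms → subL σ (renL ρ Ms) ≡ subL τ Ms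
    subL-ren e [] = refl
    subL-ren e (M ∷ Ms) = cong₂ _∷_ (sub-ren e M) (subL-ren e Ms)

  exts-var : {σ : Fin n → Tm m} {ρ : Fin n → Fin m} →
             (∀ i → σ i ≡ var (ρ i)) → ∀ i → exts σ i ≡ var (ext ρ i)
  exts-var e zero = refl
  exts-var e (suc i) = cong (ren suc) (e i)

  mutual
    sub-var : {σ : Fin n → Tm m} {ρ : Fin n → Fin m} →
              (∀ i → σ i ≡ var (ρ i)) → ∀ M → sub σ M ≡ ren ρ M
    sub-var e (var i) = e i
    sub-var e (con c) = refl
    sub-var e (M · N) = cong₂ _·_ (sub-var e M) (sub-var e N)
    sub-var e (lam M) = cong lam (sub-var (exts-var e) M)
    sub-var e (cas L Ms) = cong₂ cas (sub-var e L) (subL-var e Ms)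
    sub-var e (rec L Ms) = cong₂ rec (sub-var e L) (subL-var e Ms)

    subL-var : {σ : Fin n → Tm m} {ρ : Fin n → Fin m} →
               (∀ i → σ i ≡ var (ρ i)) → ∀ Ms → subL σ Ms ≡ renL ρ Ms
    subL-var e [] = refl
    subL-var e (M ∷ Ms) = cong₂ _∷_ (sub-var e M) (subL-var e Ms)

  ext-id : {ρ : Fin n → Fin n} → (∀ i → ρ i ≡ i) → ∀ i → ext ρ i ≡ i
  ext-id e zero = refl
  ext-id e (suc i) = cong suc (e i)

  mutual
    ren-id : {ρ : Fin n → Fin n} → (∀ i → ρ i ≡ i) → ∀ M → ren ρ M ≡ M
    ren-id e (var i) = cong var (e i)
    ren-id e (con c) = refl
    ren-id e (M · N) = cong₂ _·_ (ren-id e M) (ren-id e N)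
    ren-id e (lam M) = cong lam (ren-id (ext-id e) M)
    ren-id e (cas L Ms) = cong₂ cas (ren-id e L) (renL-id e Ms)
    ren-id e (rec L Ms) = cong₂ rec (ren-id e L) (renL-id e Ms)

    renL-id : {ρ : Fin n → Fin n} → (∀ i → ρ i ≡ i) → ∀ Ms → renL ρ Ms ≡ Ms
    renL-id e [] = refl
    renL-id e (M ∷ Ms) = cong₂ _∷_ (ren-id e M) (renL-id e Ms)

  up : Tm 0 → Tm n
  up = ren (λ ())

  up-closed : (M : Tm 0) → up M ≡ M
  up-closed = ren-id (λ ())

  sub-up : (σ : Fin n → Tm m) (M : Tm 0) → sub σ (up M) ≡ up M
  sub-up σ M = trans (sub-ren {τ = λ ()} (λ ()) M) (sub-var (λ ()) M)

  ren-up : (ρ : Fin n → Fin m) (M : Tm 0) → ren ρ (up M) ≡ up M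
  ren-up ρ M = trans (sym (sub-var (λ _ → refl) (up M))) (sub-up (var ∘ ρ) M)

  -- Only closed values are ever substituted below, so what a β-step leaves behind are
  -- substitution instances of weakened closed terms; ≡↑ tracks them back to the original.
  infix 4 _≡↑_
  _≡↑_ : Tm n → Tm 0 → Set
  M ≡↑ V = M ≡ up V

  ↑-refl : (V : Tm 0) → V ≡↑ V
  ↑-refl V = sym (up-closed V)

  ↑-ren : {ρ : Fin n → Fin m} {M : Tm n} {V : Tm 0} → M ≡↑ V → ren ρ M ≡↑ V
  ↑-ren {ρ = ρ} {V = V} refl = ren-up ρ V

  ↑-sub : {σ : Fin n → Tm m} {M : Tm n} {V : Tm 0} → M ≡↑ V → sub σ M ≡↑ V
  ↑-sub {σ = σ} {V = V} refl = sub-up σ V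

  ↑-closed : {M V : Tm 0} → M ≡↑ V → M ≡ V
  ↑-closed {V = V} e = trans e (up-closed V)

  -- Numerals and recursion on 𝕌

  numeral-ct : ∀ m → IsCT ⌜ m ⌝
  numeral-ct zero = con _
  numeral-ct (suc m) = app (con _) (numeral-ct m)

  numeral-value : ∀ m → Value ⌜ m ⌝
  numeral-value m = ct (numeral-ct m)

  private
    reindex : {l l′ : List ℕ} → l ≡ l′ → Fin (length l′) → Fin (length l)
    reindex e = subst (λ l → Fin (length l)) (sym e)

    toℕ-reindex : {l l′ : List ℕ} (e : l ≡ l′) (i : Fin (length l′)) → toℕ (reindex e i) ≡ toℕ i
    toℕ-reindex refl i = refl

    lookup-reindex : {l l′ : List ℕ} (e : l ≡ l′) (i : Fin (length l′)) →
                     L.lookup l (reindex e i) ≡ L.lookup l′ i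
    lookup-reindex refl i = refl

    brR-unary-nullary : {l : List ℕ} → l ≡ 1 ∷ 0 ∷ [] → ∀ A C →
      map (λ i → A ⊸^ L.lookup l i ∙ (C ⊸^ L.lookup l i ∙ C)) (allFin (length l)) ≡ (A ⊸ C ⊸ C) ∷ C ∷ []
    brR-unary-nullary refl A C = refl

  R-cU₁ : R cU₁ ≡ 1
  R-cU₁ = lookup-reindex 𝕌-sig zero

  R-cU₂ : R cU₂ ≡ 0
  R-cU₂ = lookup-reindex 𝕌-sig (suc zero)

  k-𝕌 : k 𝕌 ≡ 2
  k-𝕌 = cong length 𝕌-sig

  brR-𝕌 : ∀ C → brR 𝕌 0 C ≡ (U⁰ ⊸ C ⊸ C) ∷ C ∷ []
  brR-𝕌 = brR-unary-nullary 𝕌-sig U⁰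

  rec-suc : ∀ {S Z t : Tm n} → IsCT t → rec (con cU₁ · t) (S ∷ Z ∷ []) ⟶ (S · t · rec t (S ∷ Z ∷ []))
  rec-suc {S = S} {Z} t = rec {ts = _ ∷ []} (t ∷ []) (sym R-cU₁) (sym k-𝕌)
    (subst (λ j → Nth (S ∷ Z ∷ []) j S) (sym (toℕ-reindex 𝕌-sig zero)) here)

  rec-zero : ∀ {S Z : Tm n} → rec (con cU₂) (S ∷ Z ∷ []) ⟶ Z
  rec-zero {S = S} {Z} = rec {ts = []} [] (sym R-cU₂) (sym k-𝕌)
    (subst (λ j → Nth (S ∷ Z ∷ []) j Z) (sym (toℕ-reindex 𝕌-sig (suc zero))) (there here))

  infixl 7 _·*_ _*·_
  _*·_ : {M M′ : Tm n} → M ⇝* M′ → (N : Tm n) → (M · N) ⇝* (M′ · N)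
  r *· N = gmap (_· N) appl r

  _·*_ : (M : Tm n) {N N′ : Tm n} → N ⇝* N′ → (M · N) ⇝* (M · N′)
  M ·* r = gmap (M ·_) appr r

  apps* : {M M′ : Tm n} (Ns : List (Tm n)) → M ⇝* M′ → apps M Ns ⇝* apps M′ Ns
  apps* [] r = r
  apps* (N ∷ Ns) r = apps* Ns (r *· N)

  β↠ : {B : Tm 1} {V N : Tm 0} → Value V → B [ V ]₀ ≡ N → (lam B · V) ⇝* N
  β↠ v refl = return (root (β v))

  infix 4 _⇓_ _↠λ_
  _⇓_ : Tm 0 → (Tm 0 → Set) → Set
  M ⇓ Q = Σ (Tm 0) λ V → M ⇝* V × Q V

  _↠λ_ : Tm 0 → (ℕ → Tm 0) → Set
  M ↠λ N = Σ (Tm 1) λ B → M ⇝* lam B × (∀ m → (lam B · ⌜ m ⌝) ⇝* N m)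

  private variable
    M M′ A B K V G H : Tm 0
    Q : Tm 0 → Set
    P : X → Tm 0 → Set

  ⇓-back : M ⇝* M′ → M′ ⇓ Q → M ⇓ Q
  ⇓-back r (V , r′ , q) = V , r ◅◅ r′ , q

  -- Combinators and their reduction laws

  I : Tm n
  I = lam (var (# 0))

  discard : ℕ → Tm 0
  discard zero = I
  discard (suc n) = lam (lam (up (discard n) · var (# 1)))

  discard-value : ∀ n → Value (discard n)
  discard-value zero = lam _
  discard-value (suc n) = lam _

  discard-law : Value V → discard (suc n) · V ↠λ λ _ → discard n · V
  discard-law {V = V} v = _ , return (root (β v)) , λ m → β↠ (numeral-value m)
    (cong₂ _·_ (↑-closed (↑-sub (↑-sub refl))) (↑-closed (↑-sub (↑-ren (↑-refl V)))))

  copy-base copy-step : Tm n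
  copy-base = lam (var (# 0) · con cU₂ · con cU₂)
  copy-step = lam (lam (lam (var (# 1) ·
    lam (lam (var (# 2) · (con cU₁ · var (# 1)) · (con cU₁ · var (# 0)))))))

  copy : Tm n
  copy = lam (rec (var (# 0)) (copy-step ∷ copy-base ∷ []))

  succ-cont : Tm 0 → Tm 0
  succ-cont K = lam (lam (up K · (con cU₁ · var (# 1)) · (con cU₁ · var (# 0))))

  succ-cont-law : ∀ a b → (succ-cont K · ⌜ a ⌝ · ⌜ b ⌝) ⇝* (K · ⌜ suc a ⌝ · ⌜ suc b ⌝)
  succ-cont-law a b = appl (root (β (numeral-value a))) ◅ β↠ (numeral-value b)
    (cong₂ _·_ (cong₂ _·_ (↑-closed (↑-sub (↑-sub refl)))
                          (cong (con cU₁ ·_) (↑-closed (↑-sub (↑-ren (↑-refl _))))))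
               refl)

  Duplicates : ℕ → Tm 0 → Set
  Duplicates m D = Value D × (∀ {K} → Value K → (D · K) ⇝* (K · ⌜ m ⌝ · ⌜ m ⌝))

  copy-iterate : ∀ m → rec ⌜ m ⌝ (copy-step ∷ copy-base ∷ []) ⇓ Duplicates m
  copy-iterate zero = copy-base , return (root rec-zero) , lam _ , λ vK → return (root (β vK))
  copy-iterate (suc m) =
    let D , r , vD , dup = copy-iterate m in
    _ , (root (rec-suc (numeral-ct m)) ◅ (copy-step · ⌜ m ⌝) ·* r ◅◅
         (appl (root (β (numeral-value m))) ◅ return (root (β vD)))) ,
    lam _ , λ vK → β↠ vK
      (cong₂ _·_ (↑-closed (↑-sub (↑-ren (↑-refl D))))
                 (cong lam (cong lam (cong₂ _·_ (cong₂ _·_ (↑-ren (↑-ren (↑-refl _))) refl) refl))))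
      ◅◅ dup (lam _) ◅◅ succ-cont-law m m

  copy-law : ∀ m → Value K → (copy · ⌜ m ⌝ · K) ⇝* (K · ⌜ m ⌝ · ⌜ m ⌝)
  copy-law m vK =
    let _ , r , _ , dup = copy-iterate m in
    appl (root (β (numeral-value m))) ◅ r *· _ ◅◅ dup vK

  share : ℕ → Tm 0
  share zero = lam (lam (var (# 1) · var (# 0)))
  share (suc n) = lam (lam (lam (copy · var (# 0) ·
    lam (lam (up (share n) · (var (# 4) · var (# 1)) · (var (# 3) · var (# 0)))))))

  share-zero-law : Value A → Value B → (share 0 · A · B) ⇝* (A · B)
  share-zero-law vA vB =
    appl (root (β vA)) ◅ β↠ vB (cong₂ _·_ (↑-closed (↑-sub (↑-ren (↑-refl _)))) refl)

  share-cont : ℕ → Tm 0 → Tm 0 → Tm 0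
  share-cont n A B = lam (lam (up (share n) · (up A · var (# 1)) · (up B · var (# 0))))

  share-cont-law : ∀ a b → (share-cont n A B · ⌜ a ⌝ · ⌜ b ⌝) ⇝* (share n · (A · ⌜ a ⌝) · (B · ⌜ b ⌝))
  share-cont-law a b = appl (root (β (numeral-value a))) ◅ β↠ (numeral-value b)
    (cong₂ _·_ (cong₂ _·_ (↑-closed (↑-sub (↑-sub refl)))
                          (cong₂ _·_ (↑-closed (↑-sub (↑-sub refl)))
                                     (↑-closed (↑-sub (↑-ren (↑-refl _))))))
               (cong₂ _·_ (↑-closed (↑-sub (↑-sub refl))) refl))

  share-law : Value A → Value B → share (suc n) · A · B ↠λ λ m → share n · (A · ⌜ m ⌝) · (B · ⌜ m ⌝)
  share-law vA vB = _ , (appl (root (β vA)) ◅ return (root (β vB))) ,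
    λ m → β↠ (numeral-value m)
      (cong₂ _·_ refl (cong lam (cong lam (cong₂ _·_
        (cong₂ _·_ (↑-sub (↑-sub (↑-sub refl)))
                   (cong₂ _·_ (↑-sub (↑-sub (↑-ren (↑-ren (↑-ren (↑-ren (↑-refl _))))))) refl))
        (cong₂ _·_ (↑-sub (↑-ren (↑-ren (↑-ren (↑-refl _))))) refl)))))
      ◅◅ copy-law m (lam _) ◅◅ share-cont-law m m

  flip : Tm n
  flip = lam (lam (lam (var (# 2) · var (# 0) · var (# 1))))

  flip-law : ∀ x → Value A → flip · A · ⌜ x ⌝ ↠λ λ z → A · ⌜ z ⌝ · ⌜ x ⌝
  flip-law x vA = _ , (appl (root (β vA)) ◅ return (root (β (numeral-value x)))) ,
    λ z → β↠ (numeral-value z)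
      (cong₂ _·_ (cong₂ _·_ (↑-closed (↑-sub (↑-sub (↑-ren (↑-ren (↑-refl _)))))) refl)
                 (↑-closed (↑-sub (↑-ren (↑-refl _)))))

  rotate : ℕ → Tm 0
  rotate zero = I
  rotate (suc n) = lam (lam (up (rotate n) · (flip · var (# 1) · var (# 0))))

  rotate-law : Value A → rotate (suc n) · A ↠λ λ x → rotate n · (flip · A · ⌜ x ⌝)
  rotate-law vA = _ , return (root (β vA)) , λ x → β↠ (numeral-value x)
    (cong₂ _·_ (↑-closed (↑-sub (↑-sub refl)))
               (cong₂ _·_ (cong₂ _·_ refl (↑-closed (↑-sub (↑-ren (↑-refl _))))) refl))

  primrec-step : ℕ → Tm 0 → Tm 0
  primrec-step n H = lam (up (share n) · (up (rotate n) · (up H · var (# 0))))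

  primrec : ℕ → Tm 0 → Tm 0 → Tm 0
  primrec n G H = lam (rec (var (# 0)) (up (primrec-step n H) ∷ up G ∷ []))

  primrec-law : primrec n G H ↠λ λ y → rec ⌜ y ⌝ (primrec-step n H ∷ G ∷ [])
  primrec-law = _ , Star.ε , λ y → β↠ (numeral-value y)
    (cong (rec _) (cong₂ _∷_ (↑-closed (↑-sub refl)) (cong₂ _∷_ (↑-closed (↑-sub refl)) refl)))

  primrec-suc-law : ∀ y → rec ⌜ suc y ⌝ (primrec-step n H ∷ G ∷ []) ⇝*
                    (share n · (rotate n · (H · ⌜ y ⌝)) · rec ⌜ y ⌝ (primrec-step n H ∷ G ∷ []))
  primrec-suc-law y = root (rec-suc (numeral-ct y)) ◅ β↠ (numeral-value y)
    (cong₂ _·_ (↑-closed (↑-sub refl))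
               (cong₂ _·_ (↑-closed (↑-sub refl)) (cong₂ _·_ (↑-closed (↑-sub refl)) refl))) *· _

  proj-term : Fin n → Tm 0
  proj-term {suc n} zero = discard n
  proj-term (suc i) = discard 1 · proj-term i

  mutual
    encode : PR n → Tm 0
    encode {n} zer = discard n · ⌜ 0 ⌝
    encode succ = con cU₁
    encode (proj i) = proj-term i
    encode {n} (comp h gs) = compose n (discard n · encode h) gs
    encode {suc n} (prec g h) = primrec n (encode g) (encode h)

    compose : ∀ n → Tm 0 → Vec (PR n) m → Tm 0
    compose n A [] = A
    compose n A (g ∷ gs) = compose n (share n · A · encode g) gs

  -- Representation

  Num : ℕ → Tm 0 → Set
  Num x V = V ≡ ⌜ x ⌝

  -- Rep is deliberately transparent: Repᵛ (suc m) P and Repᵛ 1 (Repᵛ m P) are then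
  -- definitionally equal, so a function of m + 1 arguments can be consumed one argument
  -- at a time. As Rep is not injective, lemmas take the arity explicitly where
  -- unification could not recover it.
  mutual
    Repᵛ : ∀ n → (X → Tm 0 → Set) → Curried n X → Tm 0 → Set
    Repᵛ zero P x V = P x V
    Repᵛ (suc n) P f V = Value V × (∀ m → Rep n P (f m) (V · ⌜ m ⌝))

    Rep : ∀ n → (X → Tm 0 → Set) → Curried n X → Tm 0 → Set
    Rep n P f M = M ⇓ Repᵛ n P f

  Rep-app : ∀ n {f : Curried (suc n) X} → Rep (suc n) P f M → ∀ m → Rep n P (f m) (M · ⌜ m ⌝)
  Rep-app _ (V , r , _ , k) m = ⇓-back (r *· _) (k m)

  Rep-lam : ∀ n {N} {f : Curried (suc n) X} → M ↠λ N → (∀ m → Rep n P (f m) (N m)) → Rep (suc n) P f M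
  Rep-lam _ (B , r , β-m) k = lam B , r , lam B , λ m → ⇓-back (β-m m) (k m)

  Repᵛ-value : ∀ n {f : Curried n ℕ} → Repᵛ n Num f V → Value V
  Repᵛ-value zero refl = numeral-value _
  Repᵛ-value (suc n) (v , _) = v

  Rep⇒reduces : ∀ n {f : Curried n ℕ} → Rep n Num f M →
                (xs : Vec ℕ n) → apps M (map ⌜_⌝ (toList xs)) ⇝* ⌜ f $ⁿ xs ⌝
  Rep⇒reduces zero (V , r , refl) [] = r
  Rep⇒reduces (suc n) (V , r , _ , k) (x ∷ xs) =
    apps* (map ⌜_⌝ (toList xs)) (r *· ⌜ x ⌝) ◅◅ Rep⇒reduces n (k x) xs

  discard-rep : ∀ n {x : X} → Value V → P x V → Rep n P (constⁿ n x) (discard n · V)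
  discard-rep zero v p = _ , return (root (β v)) , p
  discard-rep (suc n) v p = Rep-lam n (discard-law v) λ _ → discard-rep n v p

  discard-rep-Num : ∀ n m {f : Curried m ℕ} → Rep m Num f M →
                    Rep n (Repᵛ m Num) (constⁿ n f) (discard n · M)
  discard-rep-Num n m (V , r , v) = ⇓-back (_ ·* r) (discard-rep n (Repᵛ-value m v) v)

  share-rep : ∀ n {a : Curried n (ℕ → X)} {b} → Rep n (Repᵛ 1 P) a A → Rep n Num b B →
              Rep n P (shareⁿ n a b) (share n · A · B)
  share-rep zero (_ , rA , vA , kA) (_ , rB , refl) =
    ⇓-back ((_ ·* rA) *· _ ◅◅ _ ·* rB ◅◅ share-zero-law vA (numeral-value _)) (kA _)
  share-rep (suc n) (_ , rA , vA , kA) (_ , rB , vB , kB) =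
    ⇓-back ((_ ·* rA) *· _ ◅◅ _ ·* rB) (Rep-lam n (share-law vA vB) λ m → share-rep n (kA m) (kB m))

  rotate-rep : ∀ n {a : Curried (suc n) X} → Rep (suc n) P a A →
               Rep n (Repᵛ 1 P) (rotateⁿ n a) (rotate n · A)
  rotate-rep zero (_ , r , vA , kA) = ⇓-back (_ ·* r) (_ , return (root (β vA)) , vA , kA)
  rotate-rep (suc n) {a} (_ , r , vA , kA) = ⇓-back (_ ·* r) (Rep-lam n (rotate-law vA) λ x →
    rotate-rep n {λ z → a z x} (Rep-lam n (flip-law x vA) λ z → Rep-app n (kA z) x))

  primrec-rep : ∀ n {g h} → Rep n Num g G → Rep (suc (suc n)) Num h H →
                Rep (suc n) Num (primrecⁿ n g h) (primrec n G H)
  primrec-rep {G = G} {H = H} n {g} {h} rG rH = Rep-lam n primrec-law iterate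
    where
    iterate : ∀ y → Rep n Num (primrecⁿ n g h y) (rec ⌜ y ⌝ (primrec-step n H ∷ G ∷ []))
    iterate zero = ⇓-back (return (root rec-zero)) rG
    iterate (suc y) =
      ⇓-back (primrec-suc-law y) (share-rep n (rotate-rep n (Rep-app (suc n) rH y)) (iterate y))

  proj-rep : (i : Fin n) → Rep n Num (projⁿ i) (proj-term i)
  proj-rep {suc n} zero = _ , Star.ε , discard-value n , λ m → discard-rep n (numeral-value m) refl
  proj-rep {suc n} (suc i) = discard-rep-Num 1 n (proj-rep i)

  mutual
    encode-rep : (f : PR n) → Rep n Num ⟦ f ⟧ (encode f)
    encode-rep {n} zer = discard-rep n (numeral-value 0) refl
    encode-rep succ = _ , Star.ε , ct (con cU₁) , λ m → ⌜ suc m ⌝ , Star.ε , refl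
    encode-rep (proj i) = proj-rep i
    encode-rep {n} (comp {m} h gs) = compose-rep n gs (discard-rep-Num n m (encode-rep h))
    encode-rep {suc n} (prec g h) = primrec-rep n (encode-rep g) (encode-rep h)

    compose-rep : ∀ n {a : Curried n (Curried m ℕ)} (gs : Vec (PR n) m) →
                  Rep n (Repᵛ m Num) a A → Rep n Num (composeⁿ a gs) (compose n A gs)
    compose-rep n [] rA = rA
    compose-rep n (g ∷ gs) rA = compose-rep n gs (share-rep n rA (encode-rep g))

  -- Typing

  ε-split : Split (ε {n}) ε ε
  ε-split {zero} = []
  ε-split {suc n} = none ε-split

  split-all-left : (Γ : Ctx n) → Split Γ Γ ε
  split-all-left [] = []
  split-all-left (nothing ∷ Γ) = none (split-all-left Γ)
  split-all-left (just _ ∷ Γ) = left (split-all-left Γ)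

  split-all-right : (Γ : Ctx n) → Split Γ ε Γ
  split-all-right [] = []
  split-all-right (nothing ∷ Γ) = none (split-all-right Γ)
  split-all-right (just _ ∷ Γ) = right (split-all-right Γ)

  wk₀ : ∀ {Γ : Ctx n} {M A B} → (nothing ∷ Γ) ⊢ M ∶ B → (just A ∷ Γ) ⊢ M ∶ B
  wk₀ = wk {i = zero} refl

  infix 3 ⊢↑_∶_
  ⊢↑_∶_ : Tm 0 → Ty → Set
  ⊢↑ M ∶ A = ∀ {p} → ε {p} ⊢ up M ∶ A

  ⊢ren-up : ∀ {M A} {ρ : Fin n → Fin m} → ⊢↑ M ∶ A → ε ⊢ ren ρ (up M) ∶ A
  ⊢ren-up {M = M} {ρ = ρ} d = subst (λ t → ε ⊢ t ∶ _) (sym (ren-up ρ M)) d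

  ⊢↑-app : ∀ {M N A B} → ⊢↑ M ∶ (A ⊸ B) → ⊢↑ N ∶ A → ⊢↑ M · N ∶ B
  ⊢↑-app dM dN = ⊸E ε-split dM dN

  ⊢cU₁ : ε {n} ⊢ con cU₁ ∶ (U⁰ ⊸ U⁰)
  ⊢cU₁ {n} = subst (λ r → ε {n} ⊢ con cU₁ ∶ (U⁰ ⊸^ r ∙ U⁰)) R-cU₁ conI

  ⊢cU₂ : ε {n} ⊢ con cU₂ ∶ U⁰
  ⊢cU₂ {n} = subst (λ r → ε {n} ⊢ con cU₂ ∶ (U⁰ ⊸^ r ∙ U⁰)) R-cU₂ conI

  ⊢rec-𝕌 : ∀ {Δ : Ctx n} {S Z L C} → ε ⊢ S ∶ (U⁰ ⊸ C ⊸ C) → ε ⊢ Z ∶ C → Δ ⊢ L ∶ U⁰ →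
           Δ ⊢ rec L (S ∷ Z ∷ []) ∶ C
  ⊢rec-𝕌 dS dZ dL =
    recE (subst (ε ⊢* _ ∶_) (sym (brR-𝕌 _)) (cons ε-split dS (cons ε-split dZ []))) dL

  ⊢discard : ∀ n {A} → ⊢↑ discard n ∶ (A ⊸ (U⁰ ⊸^ n ∙ A))
  ⊢discard zero = ⊸I ax
  ⊢discard (suc n) = ⊸I (⊸I (wk₀ (⊸E (none (right ε-split)) (⊢ren-up (⊢discard n)) ax)))

  ⊢copy : ∀ {D} → ε {n} ⊢ copy ∶ (U⁰ ⊸ (U⁰ ⊸ U⁰ ⊸ D) ⊸ D)
  ⊢copy = ⊸I (⊢rec-𝕌 ⊢step ⊢base ax)
    where
    ⊢base = ⊸I (⊸E (split-all-left _) (⊸E (split-all-left _) ax ⊢cU₂) ⊢cU₂)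
    ⊢step = ⊸I (wk₀ (⊸I (⊸I (⊸E (right (left (none ε-split))) ax (⊸I (⊸I
      (⊸E (right (left (left (none (none ε-split)))))
          (⊸E (none (right (left (none (none ε-split))))) ax (⊸E (split-all-right _) ⊢cU₁ ax))
          (⊸E (split-all-right _) ⊢cU₁ ax))))))))

  ⊢share : ∀ n {D} → ⊢↑ share n ∶ ((U⁰ ⊸^ n ∙ (U⁰ ⊸ D)) ⊸ (U⁰ ⊸^ n ∙ U⁰) ⊸ (U⁰ ⊸^ n ∙ D))
  ⊢share zero = ⊸I (⊸I (⊸E (right (left ε-split)) ax ax))
  ⊢share (suc n) = ⊸I (⊸I (⊸I (⊸E (left (right (right ε-split)))
    (⊸E (split-all-right _) ⊢copy ax)
    (⊸I (⊸I (⊸E (right (left (none (right (left ε-split)))))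
      (⊸E (split-all-right _) (⊢ren-up (⊢share n))
          (⊸E (none (right (none (none (left ε-split))))) ax ax))
      (⊸E (right (none (none (left (none ε-split))))) ax ax)))))))

  ⊢flip : ∀ {A B C} → ε {n} ⊢ flip ∶ ((A ⊸ B ⊸ C) ⊸ B ⊸ A ⊸ C)
  ⊢flip = ⊸I (⊸I (⊸I (⊸E (left (right (left ε-split))) (⊸E (right (none (left ε-split))) ax ax) ax)))

  ⊢rotate : ∀ n {D} → ⊢↑ rotate n ∶ ((U⁰ ⊸ (U⁰ ⊸^ n ∙ D)) ⊸ (U⁰ ⊸^ n ∙ (U⁰ ⊸ D)))
  ⊢rotate zero = ⊸I ax
  ⊢rotate (suc n) = ⊸I (⊸I (⊸E (split-all-right _) (⊢ren-up (⊢rotate n))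
    (⊸E (right (left ε-split)) (⊸E (split-all-right _) ⊢flip ax) ax)))

  ⊢primrec : ∀ n {G H} → ⊢↑ G ∶ (U⁰ ⊸^ n ∙ U⁰) → ⊢↑ H ∶ (U⁰ ⊸ U⁰ ⊸ (U⁰ ⊸^ n ∙ U⁰)) →
             ⊢↑ primrec n G H ∶ (U⁰ ⊸ (U⁰ ⊸^ n ∙ U⁰))
  ⊢primrec n dG dH = ⊸I (⊢rec-𝕌 (⊢ren-up ⊢step) (⊢ren-up dG) ax)
    where
    ⊢step : ⊢↑ primrec-step n _ ∶ (U⁰ ⊸ (U⁰ ⊸^ n ∙ U⁰) ⊸ (U⁰ ⊸^ n ∙ U⁰))
    ⊢step = ⊸I (⊸E (split-all-right _) (⊢ren-up (⊢share n))
      (⊸E (split-all-right _) (⊢ren-up (⊢rotate n)) (⊸E (split-all-right _) (⊢ren-up dH) ax)))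

  ⊢proj-term : (i : Fin n) → ⊢↑ proj-term i ∶ (U⁰ ⊸^ n ∙ U⁰)
  ⊢proj-term {suc n} zero = ⊢discard n
  ⊢proj-term (suc i) = ⊢↑-app (⊢discard 1) (⊢proj-term i)

  mutual
    ⊢encode : (f : PR n) → ⊢↑ encode f ∶ (U⁰ ⊸^ n ∙ U⁰)
    ⊢encode {n} zer = ⊢↑-app (⊢discard n) ⊢cU₂
    ⊢encode succ = ⊢cU₁
    ⊢encode (proj i) = ⊢proj-term i
    ⊢encode {n} (comp h gs) = ⊢compose n gs (⊢↑-app (⊢discard n) (⊢encode h))
    ⊢encode {suc n} (prec g h) = ⊢primrec n (⊢encode g) (⊢encode h)

    ⊢compose : ∀ n {A} (gs : Vec (PR n) m) → ⊢↑ A ∶ (U⁰ ⊸^ n ∙ (U⁰ ⊸^ m ∙ U⁰)) →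
               ⊢↑ compose n A gs ∶ (U⁰ ⊸^ n ∙ U⁰)
    ⊢compose n [] dA = dA
    ⊢compose n (g ∷ gs) dA = ⊢compose n gs (⊢↑-app (⊢↑-app (⊢share n) dA) (⊢encode g))

theorem5 : (𝒜 : Family) → let open H 𝒜 in
    ∀ {n} (f : PR n) →
    Σ (Tm 0) λ M →
      ([] ⊢ M ∶ (U⁰ ⊸^ n ∙ U⁰)) ×
      (∀ (ms : Vec ℕ n) → apps M (map ⌜_⌝ (toList ms)) ⇝* ⌜ eval f ms ⌝)
theorem5 𝒜 {n} f =
  encode f ,
  subst (λ M → [] ⊢ M ∶ (U⁰ ⊸^ n ∙ U⁰)) (up-closed (encode f)) (⊢encode f) ,
  λ ms → subst (λ y → apps (encode f) (map ⌜_⌝ (toList ms)) ⇝* ⌜ y ⌝) (⟦⟧-$ⁿ f ms)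
               (Rep⇒reduces n (encode-rep f) ms)
  where
  open H 𝒜
  open Representation 𝒜
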